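{- Let $\mathsf e\in\{\mathsf l,\mathsf w\}$. In the shuffling calculus the following hold: (1) $\to_\sigma$ satisfies $\mathsf e$-factorization: $\to_\sigma^*\subseteq\to_{\mathsf e\sigma}^*\cdot\to_{\neg\mathsf e\sigma}^*$; (2) $\to_{\neg\mathsf e\beta_v}\cdot\mapsto_\sigma\ \subseteq\ \to_{\mathsf e\sigma}\cdot\to_{\beta_v}$; (3) for $i\in\{1,3\}$, $\mapsto_{\sigma_i}$ is closed under substitution of values: $t\mapsto_{\sigma_i}t'$ implies $t\{x:=v\}\mapsto_{\sigma_i}t'\{x:=v\}$ for every variable $x$ and value $v$. Consequently $\to_{\mathsf{sh}}:=\to_{\beta_v}\cup\to_\sigma$ satisfies $\mathsf e$-factorization: $\to_{\mathsf{sh}}^*\subseteq(\to_{\mathsf e\beta_v}\cup\to_{\mathsf e\sigma})^*\cdot(\to_{\neg\mathsf e\beta_v}\cup\to_{\neg\mathsf e\sigma})^*$.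
   Context: Terms: $t::=x\mid c\mid\lambda x.t\mid tt$ modulo $\alpha$-equivalence ($c$ constants from a possibly empty set), $\mathrm{fv}(t)$ the free variables, $t\{x:=q\}$ capture-avoiding substitution. Values: $v::=x\mid c\mid\lambda x.t$. Contexts $C::=\langle\cdot\rangle\mid tC\mid Ct\mid\lambda x.C$; the contextual closure of a root relation $\mapsto_\rho$ is $C\langle r\rangle\to_\rho C\langle r'\rangle$ for $r\mapsto_\rho r'$. Rules: $(\lambda x.t)v\mapsto_{\beta_v}t\{x:=v\}$ ($v$ a value); $(\lambda x.t)us\mapsto_{\sigma_1}(\lambda x.ts)u$ if $x\notin\mathrm{fv}(s)$; $v((\lambda x.t)u)\mapsto_{\sigma_3}(\lambda x.vt)u$ if $v$ is a value and $x\notin\mathrm{fv}(v)$. $\mapsto_\sigma:=\mapsto_{\sigma_1}\cup\mapsto_{\sigma_3}$ and $\to_\sigma$ is its contextual closure. Left contexts: $L::=\langle\cdot\rangle\mid Lt\mid vL$; weak contexts: $W::=\langle\cdot\rangle\mid Wt\mid tW$. For a rule $\mapsto_\rho$, $\to_{\mathsf l\rho}$ / $\to_{\mathsf w\rho}$ is its closure under left / weak contexts, and $\to_{\neg\mathsf l\rho}$ / $\to_{\neg\mathsf w\rho}$ its closure under contexts that are not left / not weak. $\to^*$ is reflexive-transitive closure; $R\cdot S$ composition. -}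

module Defs where

open import Data.Nat using (ℕ; zero; suc; _≡ᵇ_)
open import Data.Bool using (if_then_else_)
open import Data.Product using (Σ; _×_; ∃)
open import Data.Sum using (_⊎_)
open import Data.Unit using (⊤)
open import Relation.Nullary using (¬_)
open import Relation.Binary.PropositionalEquality using (_≡_)
open import Relation.Binary.Construct.Closure.ReflexiveTransitive using (Star)

-- Terms modulo α-equivalence: locally nameless / de Bruijn indices.
-- `Const` is the (possibly empty) set of constants.

data Term (Const : Set) : Set where
  var : ℕ → Term Const
  con : Const → Term Const
  lam : Term Const → Term Const
  app : Term Const → Term Const → Term Const

Rel : Set → Set₁
Rel A = A → A → Set

module _ {Const : Set} where

  ext : (ℕ → ℕ) → ℕ → ℕ
  ext ρ zero    = zero
  ext ρ (suc n) = suc (ρ n)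

  rename : (ℕ → ℕ) → Term Const → Term Const
  rename ρ (var n)   = var (ρ n)
  rename ρ (con c)   = con c
  rename ρ (lam t)   = lam (rename (ext ρ) t)
  rename ρ (app t u) = app (rename ρ t) (rename ρ u)

  -- weakening (the bound variable of a new binder does not occur)
  shift : Term Const → Term Const
  shift = rename suc

  exts : (ℕ → Term Const) → ℕ → Term Const
  exts σ zero    = var zero
  exts σ (suc n) = shift (σ n)

  sub : (ℕ → Term Const) → Term Const → Term Const
  sub σ (var n)   = σ n
  sub σ (con c)   = con c
  sub σ (lam t)   = lam (sub (exts σ) t)
  sub σ (app t u) = app (sub σ t) (sub σ u)

  -- instantiate the bound variable (index 0) of a body with q:
  -- for  λx.t  this is  t{x:=q}
  _[_] : Term Const → Term Const → Term Const
  t [ q ] = sub (λ { zero → q ; (suc n) → var n }) t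

  _⟨_≔_⟩ : Term Const → ℕ → Term Const → Term Const
  t ⟨ x ≔ q ⟩ = sub (λ n → if n ≡ᵇ x then q else var n) t

  data Value : Term Const → Set where
    var : ∀ n → Value (var n)
    con : ∀ c → Value (con c)
    lam : ∀ t → Value (lam t)

  -- root rules
  -- (side conditions x ∉ fv(s), x ∉ fv(v) are the usual α-renaming
  --  conditions; with de Bruijn indices they become a `shift`)

  data _↦βv_ : Rel (Term Const) where
    βv : ∀ t v → Value v → app (lam t) v ↦βv (t [ v ])

  data _↦σ₁_ : Rel (Term Const) where
    σ₁ : ∀ t u s → app (app (lam t) u) s ↦σ₁ app (lam (app t (shift s))) u

  data _↦σ₃_ : Rel (Term Const) where
    σ₃ : ∀ v t u → Value v → app v (app (lam t) u) ↦σ₃ app (lam (app (shift v) t)) u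

  _∪_ : Rel (Term Const) → Rel (Term Const) → Rel (Term Const)
  (R ∪ S) t u = R t u ⊎ S t u

  _↦σ_ : Rel (Term Const)
  _↦σ_ = _↦σ₁_ ∪ _↦σ₃_

  _·_ : Rel (Term Const) → Rel (Term Const) → Rel (Term Const)
  (R · S) t u = ∃ λ s → R t s × S s u

  _⊆_ : Rel (Term Const) → Rel (Term Const) → Set
  R ⊆ S = ∀ t u → R t u → S t u

  _* : Rel (Term Const) → Rel (Term Const)
  R * = Star R

  data Ctx : Set where
    hole : Ctx
    appR : Term Const → Ctx → Ctx
    appL : Ctx → Term Const → Ctx
    lam  : Ctx → Ctx

  plug : Ctx → Term Const → Term Const
  plug hole       r = r
  plug (appR t C) r = app t (plug C r)
  plug (appL C t) r = app (plug C r) t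
  plug (lam C)    r = lam (plug C r)

  data IsLeft : Ctx → Set where
    hole : IsLeft hole
    appL : ∀ {C} t → IsLeft C → IsLeft (appL C t)
    appR : ∀ {C} v → Value v → IsLeft C → IsLeft (appR v C)

  data IsWeak : Ctx → Set where
    hole : IsWeak hole
    appL : ∀ {C} t → IsWeak C → IsWeak (appL C t)
    appR : ∀ {C} t → IsWeak C → IsWeak (appR t C)

  Closure : (Ctx → Set) → Rel (Term Const) → Rel (Term Const)
  Closure P R t t' =
    Σ Ctx λ C → P C × Σ (Term Const) λ r → Σ (Term Const) λ r' →
      R r r' × t ≡ plug C r × t' ≡ plug C r'

  →[_] : Rel (Term Const) → Rel (Term Const)
  →[ R ] = Closure (λ _ → ⊤) R

data Strat : Set where
  𝗹 𝘄 : Strat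

IsE : ∀ {Const} → Strat → Ctx {Const} → Set
IsE 𝗹 = IsLeft
IsE 𝘄 = IsWeak

module _ {Const : Set} where
  →e[_,_] : Strat → Rel (Term Const) → Rel (Term Const)
  →e[ e , R ] = Closure (IsE e) R

  →¬e[_,_] : Strat → Rel (Term Const) → Rel (Term Const)
  →¬e[ e , R ] = Closure (λ C → ¬ IsE e C) R

  _→sh_ : Rel (Term Const)
  _→sh_ = →[ _↦βv_ ] ∪ →[ _↦σ_ ]

module Submission where

-- Items (1) and the final consequence are both instances of one
-- standardization argument, carried out uniformly for the calculus with
-- rules σ₁, σ₃ only and for the full calculus βv ∪ σ₁ ∪ σ₃ (the data type
-- `Rule` below).  A *standard* reduction t ⇒ u is a sequence of e-external
-- steps from t to a term with the outermost constructor of u, followed by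
-- standard reductions of the immediate subterms.  The key lemma
-- (`standard-extend`) says that a standard reduction followed by one
-- arbitrary step can be rearranged into a standard reduction; its proof
-- needs that the root rules are stable under value substitution, which
-- is also item (3).  Reading a standard reduction off as "external steps,
-- then internal steps" (`standard-factorize`) gives factorization.
-- Item (2) is a direct case analysis of where the βv-redex sits inside a
-- σ-redex (`swap`).

open import Defs
open import Data.Product using (_×_; _,_; Σ)
open import Data.Nat using (ℕ; zero; suc; _≡ᵇ_)
open import Data.Bool using (Bool; true; false; if_then_else_)
open import Data.Sum using (_⊎_; inj₁; inj₂)
open import Data.Unit using (⊤; tt)
open import Data.Empty using (⊥; ⊥-elim)
open import Function using (_∘_)
open import Relation.Nullary using (¬_)
open import Relation.Binary.PropositionalEquality
  using (_≡_; refl; sym; trans; cong; cong₂; subst; subst₂)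
open import Relation.Binary.Construct.Closure.ReflexiveTransitive
  using (Star; ε; _◅_; _◅◅_; gmap; map; foldl)

module _ {Const : Set} where
  private
    Tm : Set
    Tm = Term Const

  ext-cong : ∀ {ρ ρ' : ℕ → ℕ} → (∀ n → ρ n ≡ ρ' n) → ∀ n → ext {Const} ρ n ≡ ext {Const} ρ' n
  ext-cong h zero    = refl
  ext-cong h (suc n) = cong suc (h n)

  rename-cong : ∀ {ρ ρ'} → (∀ n → ρ n ≡ ρ' n) → (t : Tm) → rename ρ t ≡ rename ρ' t
  rename-cong h (var n)   = cong var (h n)
  rename-cong h (con c)   = refl
  rename-cong h (lam t)   = cong lam (rename-cong (ext-cong h) t)
  rename-cong h (app t u) = cong₂ app (rename-cong h t) (rename-cong h u)

  rename-rename : ∀ {ρ ρ'} (t : Tm) → rename ρ (rename ρ' t) ≡ rename (ρ ∘ ρ') t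
  rename-rename (var n)   = refl
  rename-rename (con c)   = refl
  rename-rename {ρ} {ρ'} (lam t) = cong lam (trans (rename-rename t) (rename-cong ext-ext t))
    where ext-ext : ∀ n → ext {Const} ρ (ext {Const} ρ' n) ≡ ext {Const} (ρ ∘ ρ') n
          ext-ext zero    = refl
          ext-ext (suc n) = refl
  rename-rename (app t u) = cong₂ app (rename-rename t) (rename-rename u)

  exts-cong : ∀ {σ τ : ℕ → Tm} → (∀ n → σ n ≡ τ n) → ∀ n → exts σ n ≡ exts τ n
  exts-cong h zero    = refl
  exts-cong h (suc n) = cong shift (h n)

  sub-cong : ∀ {σ τ : ℕ → Tm} → (∀ n → σ n ≡ τ n) → (t : Tm) → sub σ t ≡ sub τ t
  sub-cong h (var n)   = h n
  sub-cong h (con c)   = refl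
  sub-cong h (lam t)   = cong lam (sub-cong (exts-cong h) t)
  sub-cong h (app t u) = cong₂ app (sub-cong h t) (sub-cong h u)

  rename-sub : ∀ {ρ} {σ : ℕ → Tm} (t : Tm) → rename ρ (sub σ t) ≡ sub (rename ρ ∘ σ) t
  rename-sub (var n)   = refl
  rename-sub (con c)   = refl
  rename-sub {ρ} {σ} (lam t) = cong lam (trans (rename-sub t) (sub-cong ext-exts t))
    where ext-exts : ∀ n → rename (ext {Const} ρ) (exts σ n) ≡ exts (rename ρ ∘ σ) n
          ext-exts zero    = refl
          ext-exts (suc n) = trans (rename-rename (σ n)) (sym (rename-rename (σ n)))
  rename-sub (app t u) = cong₂ app (rename-sub t) (rename-sub u)

  sub-rename : ∀ {σ : ℕ → Tm} {ρ} (t : Tm) → sub σ (rename ρ t) ≡ sub (σ ∘ ρ) t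
  sub-rename (var n)   = refl
  sub-rename (con c)   = refl
  sub-rename {σ} {ρ} (lam t) = cong lam (trans (sub-rename t) (sub-cong exts-ext t))
    where exts-ext : ∀ n → exts σ (ext {Const} ρ n) ≡ exts (σ ∘ ρ) n
          exts-ext zero    = refl
          exts-ext (suc n) = refl
  sub-rename (app t u) = cong₂ app (sub-rename t) (sub-rename u)

  sub-sub : ∀ {σ τ : ℕ → Tm} (t : Tm) → sub σ (sub τ t) ≡ sub (sub σ ∘ τ) t
  sub-sub (var n)   = refl
  sub-sub (con c)   = refl
  sub-sub {σ} {τ} (lam t) = cong lam (trans (sub-sub t) (sub-cong exts-exts t))
    where exts-exts : ∀ n → sub (exts σ) (exts τ n) ≡ exts (sub σ ∘ τ) n
          exts-exts zero    = refl
          exts-exts (suc n) = trans (sub-rename (τ n)) (sym (rename-sub (τ n)))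
  sub-sub (app t u) = cong₂ app (sub-sub t) (sub-sub u)

  sub-var : (t : Tm) → sub var t ≡ t
  sub-var (var n)   = refl
  sub-var (con c)   = refl
  sub-var (lam t)   = cong lam (trans (sub-cong exts-var t) (sub-var t))
    where exts-var : ∀ n → exts var n ≡ var n
          exts-var zero    = refl
          exts-var (suc n) = refl
  sub-var (app t u) = cong₂ app (sub-var t) (sub-var u)

  rename-as-sub : ∀ ρ (t : Tm) → rename ρ t ≡ sub (var ∘ ρ) t
  rename-as-sub ρ (var n)   = refl
  rename-as-sub ρ (con c)   = refl
  rename-as-sub ρ (lam t)   = cong lam (trans (rename-as-sub (ext {Const} ρ) t) (sub-cong var-ext t))
    where var-ext : ∀ n → var (ext {Const} ρ n) ≡ exts (var ∘ ρ) n
          var-ext zero    = refl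
          var-ext (suc n) = refl
  rename-as-sub ρ (app t u) = cong₂ app (rename-as-sub ρ t) (rename-as-sub ρ u)

  -- Substituting under a binder commutes with weakening (the side
  -- condition x ∉ fv(s) of σ₁ and x ∉ fv(v) of σ₃).
  sub-shift : ∀ {σ : ℕ → Tm} (s : Tm) → sub (exts σ) (shift s) ≡ shift (sub σ s)
  sub-shift s = trans (sub-rename s) (sym (rename-sub s))

  -- Substitution commutes with instantiation of a bound variable.
  -- Pointwise, index 0 is trivial and the others are  sub σ' (shift (σ n)) ≡ σ n
  -- for the instantiation σ' with  sub σ q.
  sub-instantiate : ∀ {σ : ℕ → Tm} (t q : Tm) → sub σ (t [ q ]) ≡ (sub (exts σ) t) [ sub σ q ]
  sub-instantiate {σ} t q =
    trans (sub-sub t)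
          (trans (sub-cong (λ { zero → refl
                              ; (suc n) → sym (trans (sub-rename (σ n)) (sub-var (σ n))) }) t)
                 (sym (sub-sub t)))

  ValueSub : (ℕ → Tm) → Set
  ValueSub σ = ∀ n → Value (σ n)

  value-sub : ∀ {σ : ℕ → Tm} → ValueSub σ → {t : Tm} → Value t → Value (sub σ t)
  value-sub vs (var n) = vs n
  value-sub vs (con c) = con c
  value-sub vs (lam t) = lam _

  value-rename : ∀ {ρ} {t : Tm} → Value t → Value (rename ρ t)
  value-rename (var n) = var _
  value-rename (con c) = con c
  value-rename (lam t) = lam _

  exts-value : ∀ {σ : ℕ → Tm} → ValueSub σ → ValueSub (exts σ)
  exts-value vs zero    = var zero
  exts-value vs (suc n) = value-rename (vs n)

  SubClosed : Rel Tm → Set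
  SubClosed R = ∀ σ → ValueSub σ → ∀ {a b} → R a b → R (sub σ a) (sub σ b)

  RenameClosed : Rel Tm → Set
  RenameClosed R = ∀ ρ {a b} → R a b → R (rename ρ a) (rename ρ b)

  -- Renamings are value substitutions.
  sub-closed⇒rename-closed : ∀ {R} → SubClosed R → RenameClosed R
  sub-closed⇒rename-closed {R} h ρ {a} {b} r =
    subst₂ R (sym (rename-as-sub ρ a)) (sym (rename-as-sub ρ b)) (h (var ∘ ρ) (λ n → var _) r)

  βv-sub : SubClosed _↦βv_
  βv-sub σ vs (βv t v vv) =
    subst (app (lam (sub (exts σ) t)) (sub σ v) ↦βv_) (sym (sub-instantiate t v))
          (βv _ _ (value-sub vs vv))

  σ₁-sub : ∀ (σ : ℕ → Tm) {a b} → a ↦σ₁ b → sub σ a ↦σ₁ sub σ b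
  σ₁-sub σ (σ₁ t u s) =
    subst (λ z → app (app (lam (sub (exts σ) t)) (sub σ u)) (sub σ s) ↦σ₁ app (lam (app (sub (exts σ) t) z)) (sub σ u))
          (sym (sub-shift s)) (σ₁ _ _ _)

  σ₃-sub : SubClosed _↦σ₃_
  σ₃-sub σ vs (σ₃ v t u vv) =
    subst (λ z → app (sub σ v) (app (lam (sub (exts σ) t)) (sub σ u)) ↦σ₃ app (lam (app z (sub (exts σ) t))) (sub σ u))
          (sym (sub-shift v)) (σ₃ _ _ _ (value-sub vs vv))

  single-value-sub : ∀ (x : ℕ) {v : Tm} → Value v → ValueSub (λ n → if n ≡ᵇ x then v else var n)
  single-value-sub x vv n with n ≡ᵇ x
  ... | true  = vv
  ... | false = var n

  data Rule : Bool → Rel Tm where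
    βᵣ : ∀ {a b} → a ↦βv b → Rule true a b
    σᵣ : ∀ {withβ a b} → a ↦σ b → Rule withβ a b

  rule-sub : ∀ withβ → SubClosed (Rule withβ)
  rule-sub _ σ vs (βᵣ r)         = βᵣ (βv-sub σ vs r)
  rule-sub _ σ vs (σᵣ (inj₁ r)) = σᵣ (inj₁ (σ₁-sub σ r))
  rule-sub _ σ vs (σᵣ (inj₂ r)) = σᵣ (inj₂ (σ₃-sub σ vs r))

  data Step (R : Rel Tm) : Rel Tm where
    root : ∀ {a b} → R a b → Step R a b
    appL : ∀ {a b c} → Step R a b → Step R (app a c) (app b c)
    appR : ∀ {a b c} → Step R a b → Step R (app c a) (app c b)
    lam  : ∀ {a b} → Step R a b → Step R (lam a) (lam b)

  -- For strategy e: may an e-context descend into the argument of  c ⟨·⟩ ?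
  -- (`Enters`), and when does it certainly not (`Blocks`).
  Enters : Strat → Tm → Set
  Enters 𝗹 c = Value c
  Enters 𝘄 c = ⊤

  Blocks : Strat → Tm → Set
  Blocks 𝗹 c = ¬ Value c
  Blocks 𝘄 c = ⊥

  enters-or-blocks : ∀ e (c : Tm) → Enters e c ⊎ Blocks e c
  enters-or-blocks 𝘄 c         = inj₁ tt
  enters-or-blocks 𝗹 (var n)   = inj₁ (var n)
  enters-or-blocks 𝗹 (con c)   = inj₁ (con c)
  enters-or-blocks 𝗹 (lam t)   = inj₁ (lam t)
  enters-or-blocks 𝗹 (app t u) = inj₂ (λ ())

  value-enters : ∀ e {c : Tm} → Value c → Enters e c
  value-enters 𝗹 v = v
  value-enters 𝘄 v = tt

  enters-sub : ∀ e {σ : ℕ → Tm} → ValueSub σ → {c : Tm} → Enters e c → Enters e (sub σ c)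
  enters-sub 𝗹 vs v = value-sub vs v
  enters-sub 𝘄 vs _ = tt

  data External (e : Strat) (R : Rel Tm) : Rel Tm where
    root : ∀ {a b} → R a b → External e R a b
    appL : ∀ {a b c} → External e R a b → External e R (app a c) (app b c)
    appR : ∀ {a b c} → Enters e c → External e R a b → External e R (app c a) (app c b)

  data Internal (e : Strat) (R : Rel Tm) : Rel Tm where
    lam         : ∀ {a b} → Step R a b → Internal e R (lam a) (lam b)
    appL        : ∀ {a b c} → Internal e R a b → Internal e R (app a c) (app b c)
    appR        : ∀ {a b c} → Enters e c → Internal e R a b → Internal e R (app c a) (app c b)
    appRblocked : ∀ {a b c} → Blocks e c → Step R a b → Internal e R (app c a) (app c b)

  step-map : ∀ {R S : Rel Tm} → (∀ {a b} → R a b → S a b) → ∀ {a b} → Step R a b → Step S a b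
  step-map f (root r) = root (f r)
  step-map f (appL s) = appL (step-map f s)
  step-map f (appR s) = appR (step-map f s)
  step-map f (lam s)  = lam (step-map f s)

  step-rename : ∀ {R} → RenameClosed R → RenameClosed (Step R)
  step-rename h ρ (root r) = root (h ρ r)
  step-rename h ρ (appL s) = appL (step-rename h ρ s)
  step-rename h ρ (appR s) = appR (step-rename h ρ s)
  step-rename h ρ (lam s)  = lam (step-rename h (ext {Const} ρ) s)

  external-sub : ∀ e {R} → SubClosed R → SubClosed (External e R)
  external-sub e h σ vs (root r)   = root (h σ vs r)
  external-sub e h σ vs (appL s)   = appL (external-sub e h σ vs s)
  external-sub e h σ vs (appR g s) = appR (enters-sub e vs g) (external-sub e h σ vs s)

  external-step : ∀ {e R} {a b : Tm} → External e R a b → Step R a b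
  external-step (root r)   = root r
  external-step (appL s)   = appL (external-step s)
  external-step (appR g s) = appR (external-step s)

  plug-step : ∀ {R} (C : Ctx {Const}) {r r'} → R r r' → Step R (plug C r) (plug C r')
  plug-step hole       r = root r
  plug-step (appR t C) r = appR (plug-step C r)
  plug-step (appL C t) r = appL (plug-step C r)
  plug-step (lam C)    r = lam (plug-step C r)

  closure-step : ∀ {P : Ctx → Set} {R} {a b : Tm} → Closure P R a b → Step R a b
  closure-step (C , _ , _ , _ , r , refl , refl) = plug-step C r

  in-ctx : ∀ {P : Ctx → Set} {R} (C : Ctx) → P C → ∀ {r r' : Tm} → R r r' → Closure P R (plug C r) (plug C r')
  in-ctx C p r = C , p , _ , _ , r , refl , refl

  step-closure : ∀ {R} {a b : Tm} → Step R a b → →[ R ] a b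
  step-closure (root r) = in-ctx hole tt r
  step-closure (appL {c = c} s) with step-closure s
  ... | C , _ , _ , _ , r , refl , refl = in-ctx (appL C c) tt r
  step-closure (appR {c = c} s) with step-closure s
  ... | C , _ , _ , _ , r , refl , refl = in-ctx (appR c C) tt r
  step-closure (lam s) with step-closure s
  ... | C , _ , _ , _ , r , refl , refl = in-ctx (lam C) tt r

  isE-hole : ∀ e → IsE e (hole {Const})
  isE-hole 𝗹 = hole
  isE-hole 𝘄 = hole

  isE-appL : ∀ e {C : Ctx {Const}} c → IsE e C → IsE e (appL C c)
  isE-appL 𝗹 c i = appL c i
  isE-appL 𝘄 c i = appL c i

  isE-appR : ∀ e {C : Ctx {Const}} {c} → Enters e c → IsE e C → IsE e (appR c C)
  isE-appR 𝗹 {c = c} g i = appR c g i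
  isE-appR 𝘄 {c = c} g i = appR c i

  external-closure : ∀ e {R} {a b : Tm} → External e R a b → →e[ e , R ] a b
  external-closure e (root r) = in-ctx hole (isE-hole e) r
  external-closure e (appL {c = c} s) with external-closure e s
  ... | C , i , _ , _ , r , refl , refl = in-ctx (appL C c) (isE-appL e c i) r
  external-closure e (appR {c = c} g s) with external-closure e s
  ... | C , i , _ , _ , r , refl , refl = in-ctx (appR c C) (isE-appR e g i) r

  internal-closure : ∀ e {R} {a b : Tm} → Internal e R a b → →¬e[ e , R ] a b
  internal-closure e (lam s) with step-closure s
  ... | C , _ , _ , _ , r , refl , refl = in-ctx (lam C) (not-lam e) r
    where not-lam : ∀ e {C : Ctx {Const}} → ¬ IsE e (lam C)
          not-lam 𝗹 ()
          not-lam 𝘄 ()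
  internal-closure e (appL {c = c} s) with internal-closure e s
  ... | C , ni , _ , _ , r , refl , refl = in-ctx (appL C c) (not-appL e ni) r
    where not-appL : ∀ e {C : Ctx {Const}} {c} → ¬ IsE e C → ¬ IsE e (appL C c)
          not-appL 𝗹 ni (appL _ i) = ni i
          not-appL 𝘄 ni (appL _ i) = ni i
  internal-closure e (appR {c = c} g s) with internal-closure e s
  ... | C , ni , _ , _ , r , refl , refl = in-ctx (appR c C) (not-appR e ni) r
    where not-appR : ∀ e {C : Ctx {Const}} {c} → ¬ IsE e C → ¬ IsE e (appR c C)
          not-appR 𝗹 ni (appR _ _ i) = ni i
          not-appR 𝘄 ni (appR _ i)   = ni i
  internal-closure e (appRblocked {c = c} b s) with step-closure s
  ... | C , _ , _ , _ , r , refl , refl = in-ctx (appR c C) (blocked e b) r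
    where blocked : ∀ e {C : Ctx {Const}} {c} → Blocks e c → ¬ IsE e (appR c C)
          blocked 𝗹 b (appR _ v _) = b v
          blocked 𝘄 ()

  closure-map : ∀ {P : Ctx → Set} {R S : Rel Tm} → (∀ {a b} → R a b → S a b) → ∀ {a b} → Closure P R a b → Closure P S a b
  closure-map f (C , i , r , r' , x , e₁ , e₂) = C , i , r , r' , f x , e₁ , e₂

  closure-split : ∀ {P : Ctx → Set} {a b : Tm} → Closure P (Rule true) a b → Closure P _↦βv_ a b ⊎ Closure P _↦σ_ a b
  closure-split (C , i , r , r' , βᵣ x , e₁ , e₂) = inj₁ (C , i , r , r' , x , e₁ , e₂)
  closure-split (C , i , r , r' , σᵣ x , e₁ , e₂) = inj₂ (C , i , r , r' , x , e₁ , e₂)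

  rule-σ : ∀ {a b : Tm} → Rule false a b → a ↦σ b
  rule-σ (σᵣ r) = r

  data Standard (e : Strat) (R : Rel Tm) : Rel Tm where
    s-var : ∀ {t n} → Star (External e R) t (var n) → Standard e R t (var n)
    s-con : ∀ {t c} → Star (External e R) t (con c) → Standard e R t (con c)
    s-lam : ∀ {t M M'} → Star (External e R) t (lam M) → Standard e R M M' → Standard e R t (lam M')
    s-app : ∀ {t M M' N N'} → Star (External e R) t (app M N) →
            Standard e R M M' → Standard e R N N' → Standard e R t (app M' N')

  standard-refl : ∀ {e R} (t : Tm) → Standard e R t t
  standard-refl (var n)   = s-var ε
  standard-refl (con c)   = s-con ε
  standard-refl (lam t)   = s-lam ε (standard-refl t)
  standard-refl (app t u) = s-app ε (standard-refl t) (standard-refl u)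

  standard-prepend : ∀ {e R} {a b c : Tm} → Star (External e R) a b → Standard e R b c → Standard e R a c
  standard-prepend p (s-var q)       = s-var (p ◅◅ q)
  standard-prepend p (s-con q)       = s-con (p ◅◅ q)
  standard-prepend p (s-lam q s)     = s-lam (p ◅◅ q) s
  standard-prepend p (s-app q s₁ s₂) = s-app (p ◅◅ q) s₁ s₂

  externalL : ∀ {e R} {a b c : Tm} → Star (External e R) a b → Star (External e R) (app a c) (app b c)
  externalL {c = c} = gmap (λ x → app x c) appL

  externalR : ∀ {e R} {a b c : Tm} → Enters e c → Star (External e R) a b → Star (External e R) (app c a) (app c b)
  externalR {c = c} g = gmap (app c) (appR g)

  external-rename : ∀ e {R} → SubClosed R → RenameClosed (External e R)
  external-rename e h = sub-closed⇒rename-closed (external-sub e h)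

  standard-rename : ∀ e {R} → SubClosed R → RenameClosed (Standard e R)
  standard-rename e h ρ (s-var p)       = s-var (gmap (rename ρ) (external-rename e h ρ) p)
  standard-rename e h ρ (s-con p)       = s-con (gmap (rename ρ) (external-rename e h ρ) p)
  standard-rename e h ρ (s-lam p s)     =
    s-lam (gmap (rename ρ) (external-rename e h ρ) p) (standard-rename e h (ext {Const} ρ) s)
  standard-rename e h ρ (s-app p s₁ s₂) =
    s-app (gmap (rename ρ) (external-rename e h ρ) p) (standard-rename e h ρ s₁) (standard-rename e h ρ s₂)

  standard-sub : ∀ e {R} → SubClosed R → ∀ {σ τ : ℕ → Tm} → ValueSub σ →
                 (∀ n → Standard e R (σ n) (τ n)) →
                 ∀ {M M'} → Standard e R M M' → Standard e R (sub σ M) (sub τ M')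
  standard-sub e h {σ} vs st (s-var {n = n} p) = standard-prepend (gmap (sub σ) (external-sub e h σ vs) p) (st n)
  standard-sub e h {σ} vs st (s-con p)         = s-con (gmap (sub σ) (external-sub e h σ vs) p)
  standard-sub e {R} h {σ} {τ} vs st (s-lam p s) =
    s-lam (gmap (sub σ) (external-sub e h σ vs) p) (standard-sub e h (exts-value vs) exts-standard s)
    where exts-standard : ∀ n → Standard e R (exts σ n) (exts τ n)
          exts-standard zero    = s-var ε
          exts-standard (suc n) = standard-rename e h suc (st n)
  standard-sub e h {σ} vs st (s-app p s₁ s₂) =
    s-app (gmap (sub σ) (external-sub e h σ vs) p) (standard-sub e h vs st s₁) (standard-sub e h vs st s₂)

  standard-value : ∀ {e R} {t v : Tm} → Value v → Standard e R t v →
                   Σ Tm λ w → Star (External e R) t w × Value w × Standard e R w v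
  standard-value (var n) (s-var p)   = var n , p , var n , s-var ε
  standard-value (con c) (s-con p)   = con c , p , con c , s-con ε
  standard-value (lam _) (s-lam p s) = _ , p , lam _ , s-lam ε s

  -- A root step after a standard reduction: the redex was already formed
  -- externally, so firing it there keeps the reduction standard.
  standard-root : ∀ e b {t u u' : Tm} → Standard e (Rule b) t u → Rule b u u' → Standard e (Rule b) t u'
  standard-root e b (s-app p (s-lam q sP) sV) (βᵣ (βv _ _ vV)) with standard-value vV sV
  ... | N , pN , vN , sN =
    standard-prepend (p ◅◅ externalL q ◅◅ externalR (value-enters e (lam _)) pN ◅◅ root (βᵣ (βv _ N vN)) ◅ ε)
      (standard-sub e (rule-sub b) (λ { zero → vN ; (suc n) → var n }) (λ { zero → sN ; (suc n) → s-var ε }) sP)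
  standard-root e b (s-app p (s-app q (s-lam r sP) sQ) sS) (σᵣ (inj₁ (σ₁ _ _ _))) =
    s-app (p ◅◅ externalL (q ◅◅ externalL r) ◅◅ root (σᵣ (inj₁ (σ₁ _ _ _))) ◅ ε)
          (s-lam ε (s-app ε sP (standard-rename e (rule-sub b) suc sS))) sQ
  standard-root e b (s-app p sV (s-app q (s-lam r sP) sQ)) (σᵣ (inj₂ (σ₃ _ _ _ vV))) with standard-value vV sV
  ... | M , pM , vM , sM =
    s-app (p ◅◅ externalL pM ◅◅ externalR (value-enters e vM) (q ◅◅ externalL r) ◅◅ root (σᵣ (inj₂ (σ₃ _ _ _ vM))) ◅ ε)
          (s-lam ε (s-app ε (standard-rename e (rule-sub b) suc sM) sP)) sQ

  standard-extend : ∀ e b {t u u' : Tm} → Standard e (Rule b) t u → Step (Rule b) u u' → Standard e (Rule b) t u'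
  standard-extend e b s               (root r)  = standard-root e b s r
  standard-extend e b (s-app p s₁ s₂) (appL st) = s-app p (standard-extend e b s₁ st) s₂
  standard-extend e b (s-app p s₁ s₂) (appR st) = s-app p s₁ (standard-extend e b s₂ st)
  standard-extend e b (s-lam p s)     (lam st)  = s-lam p (standard-extend e b s st)

  standardize : ∀ e b {t u : Tm} → Star (Step (Rule b)) t u → Standard e (Rule b) t u
  standardize e b = foldl (Standard e (Rule b)) (standard-extend e b) (standard-refl _)

  standard-steps : ∀ {e R} {a b : Tm} → Standard e R a b → Star (Step R) a b
  standard-steps (s-var p)       = map external-step p
  standard-steps (s-con p)       = map external-step p
  standard-steps (s-lam p s)     = map external-step p ◅◅ gmap lam lam (standard-steps s)
  standard-steps (s-app {M' = M'} {N = N} p s₁ s₂) =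
    map external-step p ◅◅ gmap (λ x → app x N) appL (standard-steps s₁) ◅◅ gmap (app M') appR (standard-steps s₂)

  Factorized : Strat → Rel Tm → Rel Tm
  Factorized e R = Star (External e R) · Star (Internal e R)

  -- Combining factorizations of the two sides of an application: if the
  -- function part M₀ lets e-contexts enter its argument, the argument's
  -- external steps stay external; otherwise all its steps are internal.
  factorize-app : ∀ e {R} {t M M₀ M' N N₀ N' : Tm} → Star (External e R) t (app M N) →
                  Star (External e R) M M₀ → Star (Internal e R) M₀ M' →
                  Star (External e R) N N₀ → Star (Internal e R) N₀ N' → Star (Step R) N N' →
                  Factorized e R t (app M' N')
  factorize-app e {M₀ = M₀} {N' = N'} p pM iM pN iN sN with enters-or-blocks e M₀
  ... | inj₁ g = _ , p ◅◅ externalL pM ◅◅ externalR g pN ,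
                 gmap (app M₀) (appR g) iN ◅◅ gmap (λ x → app x N') appL iM
  ... | inj₂ b = _ , p ◅◅ externalL pM ,
                 gmap (app M₀) (appRblocked b) sN ◅◅ gmap (λ x → app x N') appL iM

  standard-factorize : ∀ e {R} {a b : Tm} → Standard e R a b → Factorized e R a b
  standard-factorize e (s-var p)       = _ , p , ε
  standard-factorize e (s-con p)       = _ , p , ε
  standard-factorize e (s-lam p s)     = _ , p , gmap lam lam (standard-steps s)
  standard-factorize e (s-app p s₁ s₂) with standard-factorize e s₁ | standard-factorize e s₂
  ... | _ , pM , iM | _ , pN , iN = factorize-app e p pM iM pN iN (standard-steps s₂)

  Swapped : Strat → Rel Tm
  Swapped e = →e[ e , _↦σ_ ] · Step _↦βv_

  σ-at-root : ∀ e {a b : Tm} → a ↦σ b → →e[ e , _↦σ_ ] a b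
  σ-at-root e r = in-ctx hole (isE-hole e) r

  βv-rename : RenameClosed _↦βv_
  βv-rename = sub-closed⇒rename-closed βv-sub

  -- If a non-e βv-step produces a σ₁-redex, it lies inside the body t,
  -- the argument u or the outer argument s of  (λx.t) u s; the σ₁-step can
  -- be fired first (at the root, which is an e-context), after which the
  -- βv-step is still available.
  swap-σ₁ : ∀ e (C : Ctx) → ¬ IsE e C → ∀ {r r' u : Tm} → r ↦βv r' → plug C r' ↦σ₁ u → Swapped e (plug C r) u
  swap-σ₁ e hole                    ni β _ = ⊥-elim (ni (isE-hole e))
  swap-σ₁ e (appL hole s)           ni β _ = ⊥-elim (ni (isE-appL e s (isE-hole e)))
  swap-σ₁ e (appL (appL hole u) s)  ni β _ = ⊥-elim (ni (isE-appL e s (isE-appL e u (isE-hole e))))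
  swap-σ₁ e (appL (appL (lam C) u) s) ni β (σ₁ _ _ _) =
    _ , σ-at-root e (inj₁ (σ₁ _ _ _)) , appL (lam (appL (plug-step C β)))
  swap-σ₁ e (appL (appR t C) s)     ni β (σ₁ _ _ _) =
    _ , σ-at-root e (inj₁ (σ₁ _ _ _)) , appR (plug-step C β)
  swap-σ₁ e (appR t C)              ni β (σ₁ _ _ _) =
    _ , σ-at-root e (inj₁ (σ₁ _ _ _)) , appL (lam (appR (step-rename βv-rename suc (plug-step C β))))
  swap-σ₁ e (appL (appL (appL _ _) _) _) ni β ()
  swap-σ₁ e (appL (appL (appR _ _) _) _) ni β ()
  swap-σ₁ e (appL (lam _) _)        ni β ()
  swap-σ₁ e (lam _)                 ni β ()

  -- Likewise for a σ₃-redex  v ((λx.t) u): the βv-step lies inside the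
  -- value v (necessarily under its λ), the body t or the argument u.
  swap-σ₃ : ∀ e (C : Ctx) → ¬ IsE e C → ∀ {r r' u : Tm} → r ↦βv r' → plug C r' ↦σ₃ u → Swapped e (plug C r) u
  swap-σ₃ e hole                    ni β _ = ⊥-elim (ni (isE-hole e))
  swap-σ₃ e (appL hole x)           ni β _ = ⊥-elim (ni (isE-appL e x (isE-hole e)))
  swap-σ₃ e (appL (lam C) x)        ni β (σ₃ _ _ _ (lam _)) =
    _ , σ-at-root e (inj₂ (σ₃ _ _ _ (lam _))) , appL (lam (appL (step-rename βv-rename suc (lam (plug-step C β)))))
  swap-σ₃ e (appR v hole)           ni β (σ₃ _ _ _ vv) =
    ⊥-elim (ni (isE-appR e (value-enters e vv) (isE-hole e)))
  swap-σ₃ e (appR v (appL hole u))  ni β (σ₃ _ _ _ vv) =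
    ⊥-elim (ni (isE-appR e (value-enters e vv) (isE-appL e u (isE-hole e))))
  swap-σ₃ e (appR v (appL (lam C) u)) ni β (σ₃ _ _ _ vv) =
    _ , σ-at-root e (inj₂ (σ₃ _ _ _ vv)) , appL (lam (appR (plug-step C β)))
  swap-σ₃ e (appR v (appR t C))     ni β (σ₃ _ _ _ vv) =
    _ , σ-at-root e (inj₂ (σ₃ _ _ _ vv)) , appR (plug-step C β)
  swap-σ₃ e (appL (appL _ _) _)     ni β (σ₃ _ _ _ ())
  swap-σ₃ e (appL (appR _ _) _)     ni β (σ₃ _ _ _ ())
  swap-σ₃ e (appR v (appL (appL _ _) _)) ni β ()
  swap-σ₃ e (appR v (appL (appR _ _) _)) ni β ()
  swap-σ₃ e (appR v (lam _))        ni β ()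
  swap-σ₃ e (lam _)                 ni β ()

  swapped-closure : ∀ e {a u : Tm} → Swapped e a u → (→e[ e , _↦σ_ ] · →[ _↦βv_ ]) a u
  swapped-closure e (w , s , st) = w , s , step-closure st

  swap : ∀ e → (→¬e[ e , _↦βv_ {Const} ] · _↦σ_) ⊆ (→e[ e , _↦σ_ ] · →[ _↦βv_ ])
  swap e _ _ (_ , (C , ni , _ , _ , β , refl , refl) , inj₁ r) = swapped-closure e (swap-σ₁ e C ni β r)
  swap e _ _ (_ , (C , ni , _ , _ , β , refl , refl) , inj₂ r) = swapped-closure e (swap-σ₃ e C ni β r)

  factorization : ∀ e withβ {t u : Tm} → Star (Step (Rule withβ)) t u → Factorized e (Rule withβ) t u
  factorization e withβ = standard-factorize e ∘ standardize e withβ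

  σ-factorization : ∀ e → ((→[ _↦σ_ {Const} ]) *) ⊆ ((→e[ e , _↦σ_ ] *) · (→¬e[ e , _↦σ_ ] *))
  σ-factorization e t u steps with factorization e false (map (step-map σᵣ ∘ closure-step) steps)
  ... | s , ext , int = s , map (closure-map rule-σ ∘ external-closure e) ext
                          , map (closure-map rule-σ ∘ internal-closure e) int

  sh-step : ∀ {a b : Tm} → a →sh b → Step (Rule true) a b
  sh-step (inj₁ r) = step-map βᵣ (closure-step r)
  sh-step (inj₂ r) = step-map σᵣ (closure-step r)

  sh-factorization : ∀ e → (_→sh_ {Const} *) ⊆ (((→e[ e , _↦βv_ ] ∪ →e[ e , _↦σ_ ]) *) · ((→¬e[ e , _↦βv_ ] ∪ →¬e[ e , _↦σ_ ]) *))
  sh-factorization e t u steps with factorization e true (map sh-step steps)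
  ... | s , ext , int = s , map (closure-split ∘ external-closure e) ext
                          , map (closure-split ∘ internal-closure e) int

theorem7p2 : (Const : Set) (e : Strat) →
    (((→[ _↦σ_ {Const} ]) *) ⊆ ((→e[ e , _↦σ_ ] *) · (→¬e[ e , _↦σ_ ] *)))
    × ((→¬e[ e , _↦βv_ {Const} ] · _↦σ_) ⊆ (→e[ e , _↦σ_ ] · →[ _↦βv_ ]))
    × (∀ (t t' : Term Const) x v → Value v → t ↦σ₁ t' → (t ⟨ x ≔ v ⟩) ↦σ₁ (t' ⟨ x ≔ v ⟩))
    × (∀ (t t' : Term Const) x v → Value v → t ↦σ₃ t' → (t ⟨ x ≔ v ⟩) ↦σ₃ (t' ⟨ x ≔ v ⟩))
    × ((_→sh_ {Const} *)
         ⊆ (((→e[ e , _↦βv_ ] ∪ →e[ e , _↦σ_ ]) *)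
             · ((→¬e[ e , _↦βv_ ] ∪ →¬e[ e , _↦σ_ ]) *)))
theorem7p2 Const e =
    σ-factorization e
  , swap e
  , (λ t t' x v _  r → σ₁-sub _ r)
  , (λ t t' x v vv r → σ₃-sub _ (single-value-sub x vv) r)
  , sh-factorization e
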